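{- Let $G$ be a finite simple graph, with $(H,H')$ and $M$ as in the standing setting below. Let $P\in P_o(M,H)$ and write $P = m_1,h_1,m_2,\dots,h_{l-1},m_l$ with $l\ge1$, $m_i\in M$ for $1\le i\le l$ and $h_j\in H$ for $1\le j\le l-1$. Then $l\ge3$ and $\{m_1,m_l\}\subseteq H'$.
   Context: $\nu(G)$ is the maximum matching size. $B_2(G)$ is the set of pairs $(H,H')$ of edge-disjoint matchings; $\lambda_2(G)=\max\{|H|+|H'|:(H,H')\in B_2(G)\}$; $\alpha_2(G)=\max\{|H|,|H'|:(H,H')\in B_2(G),\ |H|+|H'|=\lambda_2(G)\}$; $M_2(G)=\{(H,H')\in B_2(G): |H|+|H'|=\lambda_2(G),\ |H|=\alpha_2(G)\}$. For matchings $A,B$: a path $e_1,\dots,e_l$ ($l\ge1$) is $A$-$B$ alternating if the edges with odd indices lie in $A\setminus B$ and the others in $B\setminus A$, or vice versa; it is maximal if it is not a proper subpath of another $A$-$B$ alternating path. $P_o(A,B)$ is the set of maximal $A$-$B$ alternating paths of odd length. Standing setting: over all $(H,H')\in M_2(G)$ and all maximum matchings $M$ of $G$, consider the triples maximizing $|M\cap H|$; among these, $((H,H'),M)$ is chosen to maximize $|M\cap H'|$. -}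

module Defs where

open import Data.Nat using (ℕ; _+_; _≤_; _<_)
open import Data.Fin as Fin using (Fin; toℕ)
open import Data.Product using (Σ; ∃; ∃-syntax; _×_; _,_)
open import Data.Product.Properties using (≡-dec)
open import Data.Sum using (_⊎_)
open import Data.Empty using (⊥)
open import Data.List using (List; []; _∷_; _++_; length; filter; reverse)
open import Data.List.Relation.Unary.All using (All)
open import Data.List.Relation.Unary.Unique.Propositional using (Unique)
open import Relation.Nullary using (¬_)
open import Relation.Binary.PropositionalEquality using (_≡_; _≢_)
import Data.List.Membership.DecPropositional as DecMem

-- An edge of a graph on vertex set Fin n is stored as an ordered pair (u , v)
-- with u < v, representing the unordered pair {u , v}.
Edge : ℕ → Set
Edge n = Fin n × Fin n

open module M {n : ℕ} = DecMem {A = Edge n} (≡-dec Fin._≟_ Fin._≟_)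
  using (_∈_; _∈?_; _∉_)

Normalised : ∀ {n} → Edge n → Set
Normalised (u , v) = toℕ u < toℕ v

record Graph (n : ℕ) : Set where
  field
    edges  : List (Edge n)
    unique : Unique edges
    normal : All Normalised edges
open Graph public

EdgeSubset : ∀ {n} → Graph n → List (Edge n) → Set
EdgeSubset G H = All (_∈ edges G) H × Unique H

Disjoint : ∀ {n} → Edge n → Edge n → Set
Disjoint (u , v) (x , y) = u ≢ x × u ≢ y × v ≢ x × v ≢ y

IsMatching : ∀ {n} → Graph n → List (Edge n) → Set
IsMatching G H = EdgeSubset G H ×
  (∀ e f → e ∈ H → f ∈ H → e ≢ f → Disjoint e f)

IsMaximumMatching : ∀ {n} → Graph n → List (Edge n) → Set
IsMaximumMatching G M = IsMatching G M ×
  (∀ M' → IsMatching G M' → length M' ≤ length M)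

InB2 : ∀ {n} → Graph n → List (Edge n) → List (Edge n) → Set
InB2 G H H' = IsMatching G H × IsMatching G H' × (∀ e → e ∈ H → e ∉ H')

-- (H , H') ∈ M₂(G): |H|+|H'| = λ₂(G) and |H| = α₂(G).
InM2 : ∀ {n} → Graph n → List (Edge n) → List (Edge n) → Set
InM2 G H H' = InB2 G H H'
  × (∀ K K' → InB2 G K K' → length K + length K' ≤ length H + length H')
  × (∀ K K' → InB2 G K K' → length K + length K' ≡ length H + length H'
       → length K ≤ length H × length K' ≤ length H)

∣_∩_∣ : ∀ {n} → List (Edge n) → List (Edge n) → ℕ
∣ A ∩ B ∣ = length (filter (_∈? B) A)

-- The standing setting: ((H , H') , M) is chosen, among all (H,H') ∈ M₂(G)
-- and maximum matchings M, first to maximise |M ∩ H| and then, among those,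
-- to maximise |M ∩ H'|.
StandingChoice : ∀ {n} → Graph n → List (Edge n) → List (Edge n) → List (Edge n) → Set
StandingChoice G H H' M = InM2 G H H' × IsMaximumMatching G M
  × (∀ K K' M' → InM2 G K K' → IsMaximumMatching G M' → ∣ M' ∩ K ∣ ≤ ∣ M ∩ H ∣)
  × (∀ K K' M' → InM2 G K K' → IsMaximumMatching G M'
       → ∣ M' ∩ K ∣ ≡ ∣ M ∩ H ∣ → ∣ M' ∩ K' ∣ ≤ ∣ M ∩ H' ∣)

EdgeIn : ∀ {n} → List (Edge n) → Fin n → Fin n → Set
EdgeIn A x y = (x , y) ∈ A ⊎ (y , x) ∈ A

InDiff : ∀ {n} → List (Edge n) → List (Edge n) → Fin n → Fin n → Set
InDiff A B x y = EdgeIn A x y × ¬ EdgeIn B x y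

-- A path is given by its vertex sequence v₀,…,v_l (edges e_i = {v_{i-1}, v_i}).
-- AltFrom A B vs : the path has l ≥ 1 edges, odd-indexed edges in A ∖ B and
-- even-indexed edges in B ∖ A.
AltFrom : ∀ {n} → List (Edge n) → List (Edge n) → List (Fin n) → Set
AltFrom A B [] = ⊥
AltFrom A B (x ∷ []) = ⊥
AltFrom A B (x ∷ y ∷ []) = InDiff A B x y
AltFrom A B (x ∷ y ∷ z ∷ r) = InDiff A B x y × AltFrom B A (y ∷ z ∷ r)

AltPath : ∀ {n} → List (Edge n) → List (Edge n) → List (Fin n) → Set
AltPath A B vs = Unique vs × (AltFrom A B vs ⊎ AltFrom B A vs)

Subpath : ∀ {n} → List (Fin n) → List (Fin n) → Set
Subpath vs ws = ∃[ pre ] ∃[ suf ] (ws ≡ pre ++ vs ++ suf ⊎ reverse ws ≡ pre ++ vs ++ suf)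

-- Maximal A-B alternating path: not a proper subpath of another A-B
-- alternating path, i.e. every A-B alternating path containing it as a
-- subpath has no more edges.
MaximalAltPath : ∀ {n} → List (Edge n) → List (Edge n) → List (Fin n) → Set
MaximalAltPath A B vs = AltPath A B vs
  × (∀ ws → AltPath A B ws → Subpath vs ws → length ws ≤ length vs)

-- Let P = m₁ h₁ … m_l run from x to y. If an H-edge {x , w} existed, then either w is off P and
-- P extends, contradicting maximality, or w is on P and switching M along P + {x , w} gives a
-- maximum matching meeting H in more edges, contradicting the choice of M. So both ends of P are
-- H-free. If l ≥ 2 and m₁ ∉ H', replacing h₁ by m₁ in H gives a partner of H' of the same size
-- meeting M in more edges, again contradicting the choice; so m₁ ∈ H', and m_l ∈ H' by symmetry.
-- Finally, for l ≤ 2 moving the M-edges of P into H and the H-edges of P into H' keeps two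
-- disjoint matchings without decreasing |H| + |H'| but increases |H|, contradicting α₂.

module Submission where

open import Defs
open import Data.Nat using (ℕ; zero; suc; _*_; _≤_; _<_; _+_; z≤n; s≤s; z<s)
open import Data.Nat.Properties
open import Data.Nat.Tactic.RingSolver using (solve-∀)
open import Data.Fin as Fin using (Fin)
open import Data.Product using (_×_; _,_; proj₁; proj₂; ∃-syntax)
open import Data.Product.Properties using (≡-dec)
open import Data.Sum using (_⊎_; inj₁; inj₂)
open import Data.Empty using (⊥; ⊥-elim)
open import Data.Unit using (⊤; tt)
open import Data.List using (List; []; _∷_; _++_; [_]; length; filter; reverse; reverseAcc)
open import Data.List.Properties
  using (filter-++; filter-all; filter-notAll; length-++;
         length-reverse; reverse-++; reverse-involutive; ++-assoc; ++-identityʳ)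
open import Data.List.Relation.Unary.All as All using (All; []; _∷_)
open import Data.List.Relation.Unary.All.Properties as All using (¬Any⇒All¬)
open import Data.List.Relation.Unary.Any as Any using (here; there; any?)
open import Data.List.Relation.Unary.Unique.Propositional using (Unique)
open import Data.List.Relation.Unary.AllPairs using ([]; _∷_)
import Data.List.Relation.Unary.Unique.Propositional.Properties as Unique
open import Data.List.Relation.Binary.Permutation.Propositional using (↭⇒↭ₛ; ↭-sym)
open import Data.List.Relation.Binary.Permutation.Propositional.Properties using (↭-reverse)
import Data.List.Relation.Binary.Permutation.Setoid.Properties as Permutation
open import Data.List.Membership.Propositional using (_∈_; _∉_)
open import Data.List.Membership.Propositional.Properties using (∈-filter⁺; ∈-filter⁻; ∈-++⁺ʳ; ∈-++⁻)
import Data.List.Membership.DecPropositional as DecMembership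
open import Relation.Nullary using (¬_; yes; no; ¬?)
open import Relation.Nullary.Decidable using (decidable-stable)
open import Relation.Unary using (Decidable)
open import Relation.Binary.Definitions using (DecidableEquality)
open import Relation.Binary.PropositionalEquality hiding ([_])
open import Function using (_∘_)

module _ {A : Set} {P Q : A → Set} (P? : Decidable P) (Q? : Decidable Q) where

  length-filter-mono : ∀ xs → (∀ {x} → x ∈ xs → P x → Q x) →
                       length (filter P? xs) ≤ length (filter Q? xs)
  length-filter-mono [] _ = z≤n
  length-filter-mono (x ∷ xs) P⇒Q with P? x | Q? x
  ... | yes _  | yes _  = s≤s (length-filter-mono xs (P⇒Q ∘ there))
  ... | yes px | no ¬qx = ⊥-elim (¬qx (P⇒Q (here refl) px))
  ... | no _   | yes _  = m≤n⇒m≤1+n (length-filter-mono xs (P⇒Q ∘ there))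
  ... | no _   | no _   = length-filter-mono xs (P⇒Q ∘ there)

  length-filter-strict : ∀ xs → (∀ {x} → x ∈ xs → P x → Q x) →
                         ∀ {y} → y ∈ xs → Q y → ¬ P y →
                         length (filter P? xs) < length (filter Q? xs)
  length-filter-strict (x ∷ xs) P⇒Q (here refl) qy ¬py with P? x | Q? x
  ... | yes px | _      = ⊥-elim (¬py px)
  ... | no _   | yes _  = s≤s (length-filter-mono xs (P⇒Q ∘ there))
  ... | no _   | no ¬qy = ⊥-elim (¬qy qy)
  length-filter-strict (x ∷ xs) P⇒Q (there y∈xs) qy ¬py with P? x | Q? x
  ... | yes _  | yes _  = s≤s (length-filter-strict xs (P⇒Q ∘ there) y∈xs qy ¬py)
  ... | yes px | no ¬qx = ⊥-elim (¬qx (P⇒Q (here refl) px))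
  ... | no _   | yes _  = m≤n⇒m≤1+n (length-filter-strict xs (P⇒Q ∘ there) y∈xs qy ¬py)
  ... | no _   | no _   = length-filter-strict xs (P⇒Q ∘ there) y∈xs qy ¬py

  filter-filter-absorb : ∀ xs → (∀ {x} → P x → Q x) → filter P? (filter Q? xs) ≡ filter P? xs
  filter-filter-absorb [] _ = refl
  filter-filter-absorb (x ∷ xs) P⇒Q with Q? x
  ... | yes _ with P? x
  ...   | yes _ = cong (x ∷_) (filter-filter-absorb xs P⇒Q)
  ...   | no _  = filter-filter-absorb xs P⇒Q
  filter-filter-absorb (x ∷ xs) P⇒Q | no ¬qx with P? x
  ...   | yes px = ⊥-elim (¬qx (P⇒Q px))
  ...   | no _   = filter-filter-absorb xs P⇒Q

+-exchange-≤ : ∀ a b {h h′ k k′} → a + h ≤ k + b → b + h′ ≤ k′ + a → h + h′ ≤ k + k′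
+-exchange-≤ a b {h} {h′} {k} {k′} ≤₁ ≤₂ = +-cancelˡ-≤ (a + b) (h + h′) (k + k′) (begin
  (a + b) + (h + h′)  ≡⟨ regroup a b h h′ ⟩
  (a + h) + (b + h′)  ≤⟨ +-mono-≤ ≤₁ ≤₂ ⟩
  (k + b) + (k′ + a)  ≡⟨ regroup′ k b k′ a ⟩
  (a + b) + (k + k′)  ∎)
  where
  open ≤-Reasoning
  regroup : ∀ a b h h′ → (a + b) + (h + h′) ≡ (a + h) + (b + h′)
  regroup = solve-∀
  regroup′ : ∀ k b k′ a → (k + b) + (k′ + a) ≡ (a + b) + (k + k′)
  regroup′ = solve-∀

Even : ℕ → Set
Even zero = ⊤
Even (suc zero) = ⊥
Even (suc (suc n)) = Even n

even-2* : ∀ l → Even (2 * l)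
even-2* zero = tt
even-2* (suc l) rewrite *-suc 2 l = even-2* l

module ListDifference {A : Set} (_≟_ : DecidableEquality A) where

  open DecMembership _≟_ public using (_∈?_; _∉?_)

  infixl 6 _∖_
  _∖_ : List A → List A → List A
  xs ∖ ys = filter (_∉? ys) xs

  ∈-∖⁻ : ∀ {x xs ys} → x ∈ xs ∖ ys → x ∈ xs × x ∉ ys
  ∈-∖⁻ {ys = ys} = ∈-filter⁻ (_∉? ys)

  ∈-∖⁺ : ∀ {x xs ys} → x ∈ xs → x ∉ ys → x ∈ xs ∖ ys
  ∈-∖⁺ {ys = ys} = ∈-filter⁺ (_∉? ys)

  length-∖ : ∀ xs ys → Unique xs → length xs ≤ length (xs ∖ ys) + length ys
  length-∖ [] ys _ = z≤n
  length-∖ (x ∷ xs) ys (x∉xs ∷ unique-xs) with x ∈? ys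
  ... | no x∉ys = s≤s (length-∖ xs ys unique-xs)
  ... | yes x∈ys = begin
      suc (length xs)                        ≤⟨ s≤s (length-∖ xs ys⁻ unique-xs) ⟩
      suc (length (xs ∖ ys⁻) + length ys⁻)   ≡⟨ +-suc _ _ ⟨
      length (xs ∖ ys⁻) + suc (length ys⁻)   ≤⟨ +-mono-≤ fewer-removed ys⁻<ys ⟩
      length (xs ∖ ys) + length ys           ∎
    where
    open ≤-Reasoning
    ys⁻ = filter (λ y → ¬? (x ≟ y)) ys
    ys⁻<ys : length ys⁻ < length ys
    ys⁻<ys = filter-notAll (λ y → ¬? (x ≟ y)) ys (Any.map (λ x≡y x≢y → x≢y x≡y) x∈ys)
    fewer-removed : length (xs ∖ ys⁻) ≤ length (xs ∖ ys)
    fewer-removed = length-filter-mono (_∉? ys⁻) (_∉? ys) xs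
      (λ y∈xs y∉ys⁻ y∈ys → y∉ys⁻ (∈-filter⁺ _ y∈ys (All.lookup x∉xs y∈xs)))

  length-++-∖ : ∀ xs ys zs → Unique ys → length xs + length ys ≤ length (xs ++ ys ∖ zs) + length zs
  length-++-∖ xs ys zs unique-ys = begin
    length xs + length ys                       ≤⟨ +-monoʳ-≤ (length xs) (length-∖ ys zs unique-ys) ⟩
    length xs + (length (ys ∖ zs) + length zs)  ≡⟨ +-assoc (length xs) _ _ ⟨
    length xs + length (ys ∖ zs) + length zs    ≡⟨ cong (_+ length zs) (length-++ xs) ⟨
    length (xs ++ ys ∖ zs) + length zs          ∎
    where open ≤-Reasoning

open module EdgeDifference {n : ℕ} = ListDifference {A = Edge n} (≡-dec Fin._≟_ Fin._≟_)

infix 4 _∈ᵉ_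
_∈ᵉ_ : ∀ {n} → Fin n → Edge n → Set
v ∈ᵉ (a , b) = v ≡ a ⊎ v ≡ b

module _ {n : ℕ} where

  Disjoint⇒¬shared : ∀ {e f : Edge n} {v} → Disjoint e f → v ∈ᵉ e → v ∈ᵉ f → ⊥
  Disjoint⇒¬shared (a≢c , _ , _ , _) (inj₁ refl) (inj₁ refl) = a≢c refl
  Disjoint⇒¬shared (_ , a≢d , _ , _) (inj₁ refl) (inj₂ refl) = a≢d refl
  Disjoint⇒¬shared (_ , _ , b≢c , _) (inj₂ refl) (inj₁ refl) = b≢c refl
  Disjoint⇒¬shared (_ , _ , _ , b≢d) (inj₂ refl) (inj₂ refl) = b≢d refl

  ¬shared⇒Disjoint : ∀ {e f : Edge n} → (∀ {v} → v ∈ᵉ e → v ∈ᵉ f → ⊥) → Disjoint e f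
  ¬shared⇒Disjoint {a , b} {c , d} ¬shared =
      (λ a≡c → ¬shared (inj₁ refl) (inj₁ a≡c)) , (λ a≡d → ¬shared (inj₁ refl) (inj₂ a≡d))
    , (λ b≡c → ¬shared (inj₂ refl) (inj₁ b≡c)) , (λ b≡d → ¬shared (inj₂ refl) (inj₂ b≡d))

  NormalisedList : List (Edge n) → Set
  NormalisedList X = ∀ {e} → e ∈ X → Normalised e

  edge : ∀ {X : List (Edge n)} {x y} → EdgeIn X x y → Edge n
  edge {x = x} {y} (inj₁ _) = x , y
  edge {x = x} {y} (inj₂ _) = y , x

  module _ {X : List (Edge n)} {x y : Fin n} where

    edge-∈ : (d : EdgeIn X x y) → edge d ∈ X
    edge-∈ (inj₁ xy∈X) = xy∈X
    edge-∈ (inj₂ yx∈X) = yx∈X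

    edge-∉ : ∀ {Y} (d : EdgeIn X x y) → ¬ EdgeIn Y x y → edge d ∉ Y
    edge-∉ (inj₁ _) ¬Y xy∈Y = ¬Y (inj₁ xy∈Y)
    edge-∉ (inj₂ _) ¬Y yx∈Y = ¬Y (inj₂ yx∈Y)

    edge-∈⇒EdgeIn : ∀ {Y} (d : EdgeIn X x y) → edge d ∈ Y → EdgeIn Y x y
    edge-∈⇒EdgeIn (inj₁ _) = inj₁
    edge-∈⇒EdgeIn (inj₂ _) = inj₂

    start-∈ᵉ : (d : EdgeIn X x y) → x ∈ᵉ edge d
    start-∈ᵉ (inj₁ _) = inj₁ refl
    start-∈ᵉ (inj₂ _) = inj₂ refl

    end-∈ᵉ : (d : EdgeIn X x y) → y ∈ᵉ edge d
    end-∈ᵉ (inj₁ _) = inj₂ refl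
    end-∈ᵉ (inj₂ _) = inj₁ refl

    ∈ᵉ-edge : ∀ {v} (d : EdgeIn X x y) → v ∈ᵉ edge d → v ≡ x ⊎ v ≡ y
    ∈ᵉ-edge (inj₁ _) v∈ = v∈
    ∈ᵉ-edge (inj₂ _) (inj₁ v≡y) = inj₂ v≡y
    ∈ᵉ-edge (inj₂ _) (inj₂ v≡x) = inj₁ v≡x

    edge-∈-normalised : ∀ {Y} → NormalisedList X → NormalisedList Y →
                        (d : EdgeIn X x y) → EdgeIn Y x y → edge d ∈ Y
    edge-∈-normalised _  _  (inj₁ _)    (inj₁ xy∈Y) = xy∈Y
    edge-∈-normalised _  _  (inj₂ _)    (inj₂ yx∈Y) = yx∈Y
    edge-∈-normalised nX nY (inj₁ xy∈X) (inj₂ yx∈Y) = ⊥-elim (<-asym (nX xy∈X) (nY yx∈Y))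
    edge-∈-normalised nX nY (inj₂ yx∈X) (inj₁ xy∈Y) = ⊥-elim (<-asym (nX yx∈X) (nY xy∈Y))

  EdgeIn-sym : ∀ {X : List (Edge n)} {x y} → EdgeIn X x y → EdgeIn X y x
  EdgeIn-sym (inj₁ xy∈X) = inj₂ xy∈X
  EdgeIn-sym (inj₂ yx∈X) = inj₁ yx∈X

  InDiff-sym : ∀ {X Y : List (Edge n)} {x y} → InDiff X Y x y → InDiff X Y y x
  InDiff-sym (d , ¬Y) = EdgeIn-sym d , λ d' → ¬Y (EdgeIn-sym d')

  ∈ᵉ⇒EdgeIn : ∀ {X : List (Edge n)} {f v} → f ∈ X → v ∈ᵉ f → ∃[ w ] EdgeIn X w v
  ∈ᵉ⇒EdgeIn {f = a , b} f∈X (inj₁ refl) = b , inj₂ f∈X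
  ∈ᵉ⇒EdgeIn {f = a , b} f∈X (inj₂ refl) = a , inj₁ f∈X

module Matchings {n} (G : Graph n) where

  matching-normalised : ∀ {X} → IsMatching G X → NormalisedList X
  matching-normalised ((X⊆G , _) , _) e∈X = All.lookup (normal G) (All.lookup X⊆G e∈X)

  matching-unique-at : ∀ {X e f v} → IsMatching G X → e ∈ X → f ∈ X → v ∈ᵉ e → v ∈ᵉ f → e ≡ f
  matching-unique-at {e = e} {f} (_ , disjoint) e∈X f∈X v∈e v∈f with ≡-dec Fin._≟_ Fin._≟_ e f
  ... | yes e≡f = e≡f
  ... | no e≢f = ⊥-elim (Disjoint⇒¬shared (disjoint e f e∈X f∈X e≢f) v∈e v∈f)

  matching-⊆ : ∀ {X A} → IsMatching G X → Unique A → (∀ {a} → a ∈ A → a ∈ X) → IsMatching G A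
  matching-⊆ ((X⊆G , _) , disjoint) unique-A A⊆X =
    (All.tabulate (λ a∈A → All.lookup X⊆G (A⊆X a∈A)) , unique-A) ,
    λ e f e∈A f∈A → disjoint e f (A⊆X e∈A) (A⊆X f∈A)

  exchange-matching : ∀ {X A R} → IsMatching G X → IsMatching G A → (∀ {a} → a ∈ A → a ∉ X) →
                      (∀ {a f v} → a ∈ A → v ∈ᵉ a → f ∈ X → v ∈ᵉ f → f ∈ R) →
                      IsMatching G (A ++ X ∖ R)
  exchange-matching {X} {A} {R} ((X⊆G , unique-X) , disjoint-X) ((A⊆G , unique-A) , disjoint-A) A∩X blocked =
      (All.++⁺ A⊆G (All.filter⁺ (_∉? R) X⊆G)
      , Unique.++⁺ unique-A (Unique.filter⁺ (_∉? R) unique-X)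
                   (λ (e∈A , e∈X∖R) → A∩X e∈A (proj₁ (∈-∖⁻ e∈X∖R))))
    , disjoint
    where
    disjoint : ∀ e f → e ∈ A ++ X ∖ R → f ∈ A ++ X ∖ R → e ≢ f → Disjoint e f
    disjoint e f e∈ f∈ e≢f with ∈-++⁻ A e∈ | ∈-++⁻ A f∈
    ... | inj₁ e∈A | inj₁ f∈A = disjoint-A e f e∈A f∈A e≢f
    ... | inj₂ e∈X∖R | inj₂ f∈X∖R =
          disjoint-X e f (proj₁ (∈-∖⁻ e∈X∖R)) (proj₁ (∈-∖⁻ f∈X∖R)) e≢f
    ... | inj₁ e∈A | inj₂ f∈X∖R = ¬shared⇒Disjoint λ v∈e v∈f →
          let (f∈X , f∉R) = ∈-∖⁻ f∈X∖R in f∉R (blocked e∈A v∈e f∈X v∈f)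
    ... | inj₂ e∈X∖R | inj₁ f∈A = ¬shared⇒Disjoint λ v∈e v∈f →
          let (e∈X , e∉R) = ∈-∖⁻ e∈X∖R in e∉R (blocked f∈A v∈f e∈X v∈e)

module _ {n : ℕ} where

  alt-head : ∀ {A B : List (Edge n)} {x y r} → AltFrom A B (x ∷ y ∷ r) → InDiff A B x y
  alt-head {r = []} d = d
  alt-head {r = _ ∷ _} (d , _) = d

  mutual
    oddEdges : ∀ {A B : List (Edge n)} vs → AltFrom A B vs → List (Edge n)
    oddEdges (x ∷ y ∷ []) d = edge (proj₁ d) ∷ []
    oddEdges (x ∷ y ∷ z ∷ r) (d , p) = edge (proj₁ d) ∷ evenEdges (y ∷ z ∷ r) p

    evenEdges : ∀ {A B : List (Edge n)} vs → AltFrom A B vs → List (Edge n)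
    evenEdges (x ∷ y ∷ []) _ = []
    evenEdges (x ∷ y ∷ z ∷ r) (_ , p) = oddEdges (y ∷ z ∷ r) p

  mutual
    oddEdges-⊆ : ∀ {A B : List (Edge n)} vs (p : AltFrom A B vs) {e} → e ∈ oddEdges vs p → e ∈ A × e ∉ B
    oddEdges-⊆ (x ∷ y ∷ []) (d , ¬B) (here refl) = edge-∈ d , edge-∉ d ¬B
    oddEdges-⊆ (x ∷ y ∷ z ∷ r) ((d , ¬B) , _) (here refl) = edge-∈ d , edge-∉ d ¬B
    oddEdges-⊆ (x ∷ y ∷ z ∷ r) (_ , p) (there e∈) = evenEdges-⊆ (y ∷ z ∷ r) p e∈

    evenEdges-⊆ : ∀ {A B : List (Edge n)} vs (p : AltFrom A B vs) {e} → e ∈ evenEdges vs p → e ∈ B × e ∉ A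
    evenEdges-⊆ (x ∷ y ∷ z ∷ r) (_ , p) e∈ = oddEdges-⊆ (y ∷ z ∷ r) p e∈

  mutual
    oddEdges-ends : ∀ {A B : List (Edge n)} vs (p : AltFrom A B vs) {e v} →
                    e ∈ oddEdges vs p → v ∈ᵉ e → v ∈ vs
    oddEdges-ends (x ∷ y ∷ []) (d , _) (here refl) v∈e with ∈ᵉ-edge d v∈e
    ... | inj₁ refl = here refl
    ... | inj₂ refl = there (here refl)
    oddEdges-ends (x ∷ y ∷ z ∷ r) ((d , _) , _) (here refl) v∈e with ∈ᵉ-edge d v∈e
    ... | inj₁ refl = here refl
    ... | inj₂ refl = there (here refl)
    oddEdges-ends (x ∷ y ∷ z ∷ r) (_ , p) (there e∈) v∈e = there (there (evenEdges-ends y (z ∷ r) p e∈ v∈e))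

    evenEdges-ends : ∀ {A B : List (Edge n)} x ys (p : AltFrom A B (x ∷ ys)) {e v} →
                     e ∈ evenEdges (x ∷ ys) p → v ∈ᵉ e → v ∈ ys
    evenEdges-ends x (y ∷ z ∷ r) (_ , p) e∈ v∈e = oddEdges-ends (y ∷ z ∷ r) p e∈ v∈e

  mutual
    oddEdges-unique : ∀ {A B : List (Edge n)} vs (p : AltFrom A B vs) → Unique vs → Unique (oddEdges vs p)
    oddEdges-unique (x ∷ y ∷ []) _ _ = [] ∷ []
    oddEdges-unique (x ∷ y ∷ z ∷ r) ((d , _) , p) distinct@(_ ∷ distinct-tail) =
      ¬Any⇒All¬ _ (λ e∈ → Unique.Unique[x∷xs]⇒x∉xs distinct
                              (there (evenEdges-ends y (z ∷ r) p e∈ (start-∈ᵉ d))))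
      ∷ evenEdges-unique (y ∷ z ∷ r) p distinct-tail

    evenEdges-unique : ∀ {A B : List (Edge n)} vs (p : AltFrom A B vs) → Unique vs → Unique (evenEdges vs p)
    evenEdges-unique (x ∷ y ∷ []) _ _ = []
    evenEdges-unique (x ∷ y ∷ z ∷ r) (_ , p) (_ ∷ distinct-tail) = oddEdges-unique (y ∷ z ∷ r) p distinct-tail

  oddEdges-cover : ∀ {A B : List (Edge n)} vs (p : AltFrom A B vs) → Even (length vs) →
                   ∀ {v} → v ∈ vs → ∃[ e ] e ∈ oddEdges vs p × v ∈ᵉ e
  oddEdges-cover (x ∷ y ∷ []) (d , _) _ (here refl) = _ , here refl , start-∈ᵉ d
  oddEdges-cover (x ∷ y ∷ []) (d , _) _ (there (here refl)) = _ , here refl , end-∈ᵉ d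
  oddEdges-cover (x ∷ y ∷ z ∷ w ∷ r) ((d , _) , _) _ (here refl) = _ , here refl , start-∈ᵉ d
  oddEdges-cover (x ∷ y ∷ z ∷ w ∷ r) ((d , _) , _) _ (there (here refl)) = _ , here refl , end-∈ᵉ d
  oddEdges-cover (x ∷ y ∷ z ∷ w ∷ r) (_ , (_ , p)) even (there (there v∈)) =
    let (e , e∈ , v∈e) = oddEdges-cover (z ∷ w ∷ r) p even v∈ in e , there e∈ , v∈e

  length-oddEdges : ∀ {A B : List (Edge n)} vs (p : AltFrom A B vs) → Even (length vs) →
                    length (oddEdges vs p) ≡ suc (length (evenEdges vs p))
  length-oddEdges (x ∷ y ∷ []) _ _ = refl
  length-oddEdges (x ∷ y ∷ z ∷ w ∷ r) (_ , (_ , p)) even = cong suc (length-oddEdges (z ∷ w ∷ r) p even)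

  AltFrom₀ : List (Edge n) → List (Edge n) → List (Fin n) → Set
  AltFrom₀ A B (_ ∷ []) = ⊤
  AltFrom₀ A B vs = AltFrom A B vs

  alt-∷ : ∀ {A B : List (Edge n)} {x y vs} → InDiff A B y x → AltFrom₀ B A (x ∷ vs) → AltFrom A B (y ∷ x ∷ vs)
  alt-∷ {vs = []} d _ = d
  alt-∷ {vs = _ ∷ _} d p = d , p

  AltFromAfter : List (Fin n) → List (Edge n) → List (Edge n) → List (Fin n) → Set
  AltFromAfter [] A B = AltFrom A B
  AltFromAfter (_ ∷ r) A B = AltFromAfter r B A

  alt-reverseAcc : ∀ {A B : List (Edge n)} {x y} r {acc} → AltFrom A B (x ∷ y ∷ r) → AltFrom₀ B A (x ∷ acc) →
                   AltFromAfter r A B (reverseAcc (y ∷ x ∷ acc) r)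
  alt-reverseAcc [] d q = alt-∷ (InDiff-sym d) q
  alt-reverseAcc (z ∷ r) (d , p) q = alt-reverseAcc r p (alt-∷ (InDiff-sym d) q)

  alt-after-even : ∀ {A B : List (Edge n)} r {ws} → Even (length r) → AltFromAfter r A B ws → AltFrom A B ws
  alt-after-even [] _ p = p
  alt-after-even (_ ∷ _ ∷ r) even p = alt-after-even r even p

  alt-reverse : ∀ {A B : List (Edge n)} vs → Even (length vs) → AltFrom A B vs → AltFrom A B (reverse vs)
  alt-reverse (x ∷ y ∷ r) even p = alt-after-even r even (alt-reverseAcc r p tt)

Unique-reverse : ∀ {A : Set} {xs : List A} → Unique xs → Unique (reverse xs)
Unique-reverse {A} {xs} = Permutation.Unique-resp-↭ (setoid A) (↭⇒↭ₛ (↭-sym (↭-reverse xs)))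

reverse-sandwich : ∀ {A : Set} (p m s : List A) → reverse (p ++ reverse m ++ s) ≡ reverse s ++ m ++ reverse p
reverse-sandwich p m s = begin
  reverse (p ++ reverse m ++ s)                ≡⟨ reverse-++ p (reverse m ++ s) ⟩
  reverse (reverse m ++ s) ++ reverse p        ≡⟨ cong (_++ reverse p) (reverse-++ (reverse m) s) ⟩
  (reverse s ++ reverse (reverse m)) ++ reverse p ≡⟨ cong (λ t → (reverse s ++ t) ++ reverse p) (reverse-involutive m) ⟩
  (reverse s ++ m) ++ reverse p                ≡⟨ ++-assoc (reverse s) m (reverse p) ⟩
  reverse s ++ m ++ reverse p                  ∎
  where open ≡-Reasoning

Subpath-reverse : ∀ {n} {vs ws : List (Fin n)} → Subpath (reverse vs) ws → Subpath vs ws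
Subpath-reverse {vs = vs} (pre , suf , inj₁ ws≡) =
  reverse suf , reverse pre , inj₂ (trans (cong reverse ws≡) (reverse-sandwich pre vs suf))
Subpath-reverse {vs = vs} {ws} (pre , suf , inj₂ rws≡) =
  reverse suf , reverse pre ,
  inj₁ (trans (sym (reverse-involutive ws)) (trans (cong reverse rws≡) (reverse-sandwich pre vs suf)))

-- A path of P_o(A , B), as a vertex list, whose first and last edges lie in A.
record OddMaximalAltPath {n} (A B : List (Edge n)) (vs : List (Fin n)) : Set where
  field
    distinct    : Unique vs
    maximal     : ∀ ws → AltPath A B ws → Subpath vs ws → length ws ≤ length vs
    alternating : AltFrom A B vs
    even-length : Even (length vs)
open OddMaximalAltPath

reverse-path : ∀ {n} {A B : List (Edge n)} {vs} → OddMaximalAltPath A B vs → OddMaximalAltPath A B (reverse vs)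
reverse-path {vs = vs} P = record
  { distinct    = Unique-reverse (distinct P)
  ; maximal     = λ ws alt sub → subst (length ws ≤_) (sym (length-reverse vs)) (maximal P ws alt (Subpath-reverse sub))
  ; alternating = alt-reverse vs (even-length P) (alternating P)
  ; even-length = subst Even (sym (length-reverse vs)) (even-length P)
  }

∣++∩∣ : ∀ {n} {A X Y : List (Edge n)} → (∀ {a} → a ∈ A → a ∈ Y) →
        ∣ A ++ X ∩ Y ∣ ≡ length A + ∣ X ∩ Y ∣
∣++∩∣ {A = A} {X} {Y} A⊆Y = begin
  length (filter (_∈? Y) (A ++ X))                 ≡⟨ cong length (filter-++ (_∈? Y) A X) ⟩
  length (filter (_∈? Y) A ++ filter (_∈? Y) X)    ≡⟨ length-++ (filter (_∈? Y) A) ⟩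
  length (filter (_∈? Y) A) + ∣ X ∩ Y ∣             ≡⟨ cong (λ A∩Y → length A∩Y + ∣ X ∩ Y ∣)
                                                          (filter-all (_∈? Y) (All.tabulate A⊆Y)) ⟩
  length A + ∣ X ∩ Y ∣                              ∎
  where open ≡-Reasoning

∣∖∩∣ : ∀ {n} {X R Y : List (Edge n)} → (∀ {e} → e ∈ Y → e ∉ R) → ∣ X ∖ R ∩ Y ∣ ≡ ∣ X ∩ Y ∣
∣∖∩∣ {X = X} {R} {Y} Y∩R-empty = cong length (filter-filter-absorb (_∈? Y) (_∉? R) X Y∩R-empty)

module Standing {n} (G : Graph n) (H H' M : List (Edge n)) (standing : StandingChoice G H H' M) where

  open Matchings G

  inM₂ : InM2 G H H'
  inM₂ = proj₁ standing

  matchingH : IsMatching G H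
  matchingH = proj₁ (proj₁ inM₂)

  matchingH' : IsMatching G H'
  matchingH' = proj₁ (proj₂ (proj₁ inM₂))

  H∩H'-empty : ∀ e → e ∈ H → e ∉ H'
  H∩H'-empty = proj₂ (proj₂ (proj₁ inM₂))

  maximumM : IsMaximumMatching G M
  maximumM = proj₁ (proj₂ standing)

  matchingM : IsMatching G M
  matchingM = proj₁ maximumM

  M∩H-maximal : ∀ K K' M' → InM2 G K K' → IsMaximumMatching G M' → ∣ M' ∩ K ∣ ≤ ∣ M ∩ H ∣
  M∩H-maximal = proj₁ (proj₂ (proj₂ standing))

  λ₂-bound : ∀ {K} → InB2 G K H' → length K ≤ length H
  λ₂-bound {K} inB₂ = +-cancelʳ-≤ (length H') (length K) (length H) (proj₁ (proj₂ inM₂) K H' inB₂)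

  α₂-bound : ∀ {K K'} → InB2 G K K' → length H + length H' ≤ length K + length K' → length K ≤ length H
  α₂-bound {K} {K'} inB₂ ≥λ₂ =
    proj₁ (proj₂ (proj₂ inM₂) K K' inB₂ (≤-antisym (proj₁ (proj₂ inM₂) K K' inB₂) ≥λ₂))

  InM2-replace-first : ∀ {K} → InB2 G K H' → length H ≤ length K → InM2 G K H'
  InM2-replace-first inB₂ H≤K rewrite ≤-antisym (λ₂-bound inB₂) H≤K = inB₂ , proj₂ inM₂

  H-edge-at-start-∉M : ∀ {x y r f} → AltFrom M H (x ∷ y ∷ r) → f ∈ H → x ∈ᵉ f → f ∉ M
  H-edge-at-start-∉M p f∈H x∈f f∈M =
    edge-∉ m (proj₂ (alt-head p))
      (subst (_∈ H) (matching-unique-at matchingM f∈M (edge-∈ m) x∈f (start-∈ᵉ m)) f∈H)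
    where m = proj₁ (alt-head p)

  no-extension : ∀ {w x y r} → OddMaximalAltPath M H (x ∷ y ∷ r) → EdgeIn H w x → w ∉ x ∷ y ∷ r → ⊥
  no-extension {w} {x} {y} {r} P d w∉P =
    1+n≰n (maximal P (w ∷ x ∷ y ∷ r) (¬Any⇒All¬ _ w∉P ∷ distinct P , inj₂ ((d , d∉M) , alternating P))
                     ([ w ] , [] , inj₁ (cong (w ∷_) (sym (++-identityʳ (x ∷ y ∷ r))))))
    where
    d∉M : ¬ EdgeIn M w x
    d∉M dM = H-edge-at-start-∉M (alternating P) (edge-∈ d) (end-∈ᵉ d)
               (edge-∈-normalised (matching-normalised matchingH) (matching-normalised matchingM) d dM)

  -- Switching M along the path closed up by the H-edge {w , x} gives a maximum matching meeting H more.
  no-cycle-switch : ∀ {w x y r} → OddMaximalAltPath M H (x ∷ y ∷ r) → EdgeIn H w x → w ∈ x ∷ y ∷ r → ⊥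
  no-cycle-switch {w} {x} {y} {r} P d w∈P = ≤⇒≯ (M∩H-maximal H H' Y inM₂ maximumY) M∩H<Y∩H
    where
    vs = x ∷ y ∷ r
    p = alternating P
    A = edge d ∷ evenEdges vs p
    R = oddEdges vs p
    Y = A ++ M ∖ R

    A⊆H∖M : ∀ {a} → a ∈ A → a ∈ H × a ∉ M
    A⊆H∖M (here refl) = edge-∈ d , H-edge-at-start-∉M p (edge-∈ d) (end-∈ᵉ d)
    A⊆H∖M (there a∈) = evenEdges-⊆ vs p a∈

    A-ends : ∀ {a v} → a ∈ A → v ∈ᵉ a → v ∈ vs
    A-ends (here refl) v∈a with ∈ᵉ-edge d v∈a
    ... | inj₁ refl = w∈P
    ... | inj₂ refl = here refl
    A-ends (there a∈) v∈a = there (evenEdges-ends x (y ∷ r) p a∈ v∈a)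

    unique-A : Unique A
    unique-A = ¬Any⇒All¬ _ (λ d∈ → Unique.Unique[x∷xs]⇒x∉xs (distinct P)
                                      (evenEdges-ends x (y ∷ r) p d∈ (end-∈ᵉ d)))
             ∷ evenEdges-unique vs p (distinct P)

    blocked : ∀ {a g v} → a ∈ A → v ∈ᵉ a → g ∈ M → v ∈ᵉ g → g ∈ R
    blocked a∈ v∈a g∈M v∈g with oddEdges-cover vs p (even-length P) (A-ends a∈ v∈a)
    ... | e , e∈R , v∈e =
      subst (_∈ R) (matching-unique-at matchingM (proj₁ (oddEdges-⊆ vs p e∈R)) g∈M v∈e v∈g) e∈R

    maximumY : IsMaximumMatching G Y
    maximumY = exchange-matching matchingM (matching-⊆ matchingH unique-A (λ a∈ → proj₁ (A⊆H∖M a∈)))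
                                 (λ a∈ → proj₂ (A⊆H∖M a∈)) blocked
             , λ M' matchingM' → ≤-trans (proj₂ maximumM M' matchingM') M≤Y
      where
      open ≤-Reasoning
      M≤Y : length M ≤ length Y
      M≤Y = +-cancelˡ-≤ (length A) (length M) (length Y) (begin
        length A + length M  ≤⟨ length-++-∖ A M R (proj₂ (proj₁ matchingM)) ⟩
        length Y + length R  ≡⟨ cong (length Y +_) (length-oddEdges vs p (even-length P)) ⟩
        length Y + length A  ≡⟨ +-comm (length Y) (length A) ⟩
        length A + length Y  ∎)

    M∩H<Y∩H : ∣ M ∩ H ∣ < ∣ Y ∩ H ∣
    M∩H<Y∩H = begin-strict
      ∣ M ∩ H ∣              ≡⟨ ∣∖∩∣ {X = M} (λ e∈H e∈R → proj₂ (oddEdges-⊆ vs p e∈R) e∈H) ⟨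
      ∣ M ∖ R ∩ H ∣          <⟨ m<n+m _ z<s ⟩
      length A + ∣ M ∖ R ∩ H ∣ ≡⟨ ∣++∩∣ (λ a∈ → proj₁ (A⊆H∖M a∈)) ⟨
      ∣ Y ∩ H ∣              ∎
      where open ≤-Reasoning

  start-uncovered : ∀ {x y r f} → OddMaximalAltPath M H (x ∷ y ∷ r) → f ∈ H → x ∈ᵉ f → ⊥
  start-uncovered {x} {y} {r} P f∈H x∈f with ∈ᵉ⇒EdgeIn f∈H x∈f
  ... | w , d with any? (w Fin.≟_) (x ∷ y ∷ r)
  ...   | yes w∈P = no-cycle-switch P d w∈P
  ...   | no w∉P = no-extension P d w∉P

  -- Trading the odd edges of the path into H and its even edges into H' contradicts the choice of α₂.
  no-colour-swap : ∀ {vs} (p : AltFrom M H vs) → Unique vs → Even (length vs) →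
    (∀ {a g v} → a ∈ oddEdges vs p → v ∈ᵉ a → g ∈ H → v ∈ᵉ g → g ∈ evenEdges vs p) →
    (∀ {a g v} → a ∈ evenEdges vs p → v ∈ᵉ a → g ∈ H' → v ∈ᵉ g → g ∈ oddEdges vs p) → ⊥
  no-colour-swap {vs} p distinct-vs even-vs H-blocked H'-blocked =
    1+n≰n (≤-trans H<K (α₂-bound (matchingK , matchingK' , K∩K'-empty) H+H'≤K+K'))
    where
    O = oddEdges vs p
    E = evenEdges vs p
    K = O ++ H ∖ E
    K' = E ++ H' ∖ O

    O⊆M∖H : ∀ {e} → e ∈ O → e ∈ M × e ∉ H
    O⊆M∖H = oddEdges-⊆ vs p

    E⊆H∖M : ∀ {e} → e ∈ E → e ∈ H × e ∉ M
    E⊆H∖M = evenEdges-⊆ vs p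

    matchingK : IsMatching G K
    matchingK = exchange-matching matchingH
      (matching-⊆ matchingM (oddEdges-unique vs p distinct-vs) (λ e∈ → proj₁ (O⊆M∖H e∈)))
      (λ e∈ → proj₂ (O⊆M∖H e∈)) H-blocked

    matchingK' : IsMatching G K'
    matchingK' = exchange-matching matchingH'
      (matching-⊆ matchingH (evenEdges-unique vs p distinct-vs) (λ e∈ → proj₁ (E⊆H∖M e∈)))
      (λ e∈ → H∩H'-empty _ (proj₁ (E⊆H∖M e∈))) H'-blocked

    K∩K'-empty : ∀ e → e ∈ K → e ∉ K'
    K∩K'-empty e e∈K e∈K' with ∈-++⁻ O e∈K | ∈-++⁻ E e∈K'
    ... | inj₁ e∈O   | inj₁ e∈E    = proj₂ (E⊆H∖M e∈E) (proj₁ (O⊆M∖H e∈O))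
    ... | inj₁ e∈O   | inj₂ e∈H'∖O = proj₂ (∈-∖⁻ {xs = H'} e∈H'∖O) e∈O
    ... | inj₂ e∈H∖E | inj₁ e∈E    = proj₂ (∈-∖⁻ {xs = H} e∈H∖E) e∈E
    ... | inj₂ e∈H∖E | inj₂ e∈H'∖O =
          H∩H'-empty e (proj₁ (∈-∖⁻ {xs = H} e∈H∖E)) (proj₁ (∈-∖⁻ {xs = H'} e∈H'∖O))

    O+H≤K+E : length O + length H ≤ length K + length E
    O+H≤K+E = length-++-∖ O H E (proj₂ (proj₁ matchingH))

    E+H'≤K'+O : length E + length H' ≤ length K' + length O
    E+H'≤K'+O = length-++-∖ E H' O (proj₂ (proj₁ matchingH'))

    H+H'≤K+K' : length H + length H' ≤ length K + length K'
    H+H'≤K+K' = +-exchange-≤ (length O) (length E) O+H≤K+E E+H'≤K'+O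

    H<K : length H < length K
    H<K = +-cancelʳ-≤ (length E) (suc (length H)) (length K) (begin
      suc (length H) + length E  ≡⟨ cong suc (+-comm (length H) (length E)) ⟩
      suc (length E) + length H  ≡⟨ cong (_+ length H) (length-oddEdges vs p even-vs) ⟨
      length O + length H        ≤⟨ O+H≤K+E ⟩
      length K + length E        ∎)
      where open ≤-Reasoning

  no-single-edge : ∀ {x y} → OddMaximalAltPath M H (x ∷ y ∷ []) → ⊥
  no-single-edge {x} {y} P = no-colour-swap (alternating P) (distinct P) (even-length P) H-blocked λ ()
    where
    H-blocked : ∀ {a g v} → a ∈ oddEdges (x ∷ y ∷ []) (alternating P) → v ∈ᵉ a → g ∈ H → v ∈ᵉ g → g ∈ []
    H-blocked (here refl) v∈a g∈H v∈g with ∈ᵉ-edge (proj₁ (alternating P)) v∈a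
    ... | inj₁ refl = ⊥-elim (start-uncovered P g∈H v∈g)
    ... | inj₂ refl = ⊥-elim (start-uncovered (reverse-path P) g∈H v∈g)

  start-edge-∈H' : ∀ {x y r} → OddMaximalAltPath M H (x ∷ y ∷ r) → EdgeIn H' x y
  start-edge-∈H' {r = []} P = ⊥-elim (no-single-edge P)
  start-edge-∈H' {x} {y} {z ∷ r} P = edge-∈⇒EdgeIn (proj₁ m₁) (decidable-stable (m ∈? H') ¬m∉H')
    where
    m₁ : InDiff M H x y
    m₁ = proj₁ (alternating P)
    h₁ : InDiff H M y z
    h₁ = alt-head (proj₂ (alternating P))
    m = edge (proj₁ m₁)
    h = edge (proj₁ h₁)
    K = [ m ] ++ H ∖ [ h ]

    blocked : ∀ {a g v} → a ∈ [ m ] → v ∈ᵉ a → g ∈ H → v ∈ᵉ g → g ∈ [ h ]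
    blocked (here refl) v∈m g∈H v∈g with ∈ᵉ-edge (proj₁ m₁) v∈m
    ... | inj₁ refl = ⊥-elim (start-uncovered P g∈H v∈g)
    ... | inj₂ refl = here (matching-unique-at matchingH g∈H (edge-∈ (proj₁ h₁)) v∈g (start-∈ᵉ (proj₁ h₁)))

    matchingK : IsMatching G K
    matchingK = exchange-matching matchingH
      (matching-⊆ matchingM ([] ∷ []) λ { (here refl) → edge-∈ (proj₁ m₁) })
      (λ { (here refl) → edge-∉ (proj₁ m₁) (proj₂ m₁) }) blocked

    H≤K : length H ≤ length K
    H≤K = ≤-pred (subst (suc (length H) ≤_) (+-comm (length K) 1)
                        (length-++-∖ [ m ] H [ h ] (proj₂ (proj₁ matchingH))))

    M∩H<M∩K : ∣ M ∩ H ∣ < ∣ M ∩ K ∣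
    M∩H<M∩K = length-filter-strict (_∈? H) (_∈? K) M
      (λ e∈M e∈H → ∈-++⁺ʳ [ m ] (∈-∖⁺ e∈H λ { (here e≡h) →
         edge-∉ (proj₁ h₁) (proj₂ h₁) (subst (_∈ M) e≡h e∈M) }))
      (edge-∈ (proj₁ m₁)) (here refl) (edge-∉ (proj₁ m₁) (proj₂ m₁))

    ¬m∉H' : ¬ m ∉ H'
    ¬m∉H' m∉H' = ≤⇒≯ (M∩H-maximal K H' M (InM2-replace-first inB₂ H≤K) maximumM) M∩H<M∩K
      where
      K∩H'-empty : ∀ e → e ∈ K → e ∉ H'
      K∩H'-empty e e∈K with ∈-++⁻ [ m ] e∈K
      ... | inj₁ (here e≡m) = subst (_∉ H') (sym e≡m) m∉H'
      ... | inj₂ e∈H∖h = H∩H'-empty e (proj₁ (∈-∖⁻ e∈H∖h))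
      inB₂ : InB2 G K H'
      inB₂ = matchingK , matchingH' , K∩H'-empty

  no-three-edges : ∀ {x y z w} → OddMaximalAltPath M H (x ∷ y ∷ z ∷ w ∷ []) → ⊥
  no-three-edges {x} {y} {z} {w} P = no-colour-swap p (distinct P) (even-length P) H-blocked H'-blocked
    where
    vs = x ∷ y ∷ z ∷ w ∷ []
    p = alternating P
    m₁ = proj₁ p
    h₁ = proj₁ (proj₂ p)
    m₂ = proj₂ (proj₂ p)
    normalisedM = matching-normalised matchingM
    normalisedH' = matching-normalised matchingH'
    m₁∈H' = edge-∈-normalised normalisedM normalisedH' (proj₁ m₁) (start-edge-∈H' P)
    m₂∈H' = edge-∈-normalised normalisedM normalisedH' (proj₁ m₂)
              (EdgeIn-sym (start-edge-∈H' (reverse-path P)))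

    H-blocked : ∀ {a g v} → a ∈ oddEdges vs p → v ∈ᵉ a → g ∈ H → v ∈ᵉ g → g ∈ evenEdges vs p
    H-blocked (here refl) v∈a g∈H v∈g with ∈ᵉ-edge (proj₁ m₁) v∈a
    ... | inj₁ refl = ⊥-elim (start-uncovered P g∈H v∈g)
    ... | inj₂ refl = here (matching-unique-at matchingH g∈H (edge-∈ (proj₁ h₁)) v∈g (start-∈ᵉ (proj₁ h₁)))
    H-blocked (there (here refl)) v∈a g∈H v∈g with ∈ᵉ-edge (proj₁ m₂) v∈a
    ... | inj₁ refl = here (matching-unique-at matchingH g∈H (edge-∈ (proj₁ h₁)) v∈g (end-∈ᵉ (proj₁ h₁)))
    ... | inj₂ refl = ⊥-elim (start-uncovered (reverse-path P) g∈H v∈g)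

    H'-blocked : ∀ {a g v} → a ∈ evenEdges vs p → v ∈ᵉ a → g ∈ H' → v ∈ᵉ g → g ∈ oddEdges vs p
    H'-blocked (here refl) v∈a g∈H' v∈g with ∈ᵉ-edge (proj₁ h₁) v∈a
    ... | inj₁ refl = here (matching-unique-at matchingH' g∈H' m₁∈H' v∈g (end-∈ᵉ (proj₁ m₁)))
    ... | inj₂ refl = there (here (matching-unique-at matchingH' g∈H' m₂∈H' v∈g (start-∈ᵉ (proj₁ m₂))))

  path-length≥6 : ∀ {vs} → OddMaximalAltPath M H vs → 6 ≤ length vs
  path-length≥6 {[]} P = ⊥-elim (alternating P)
  path-length≥6 {_ ∷ []} P = ⊥-elim (alternating P)
  path-length≥6 {_ ∷ _ ∷ []} P = ⊥-elim (no-single-edge P)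
  path-length≥6 {_ ∷ _ ∷ _ ∷ []} P = ⊥-elim (even-length P)
  path-length≥6 {_ ∷ _ ∷ _ ∷ _ ∷ []} P = ⊥-elim (no-three-edges P)
  path-length≥6 {_ ∷ _ ∷ _ ∷ _ ∷ _ ∷ []} P = ⊥-elim (even-length P)
  path-length≥6 {_ ∷ _ ∷ _ ∷ _ ∷ _ ∷ _ ∷ r} P = m≤m+n 6 (length r)

lemma5 : ∀ {n} (G : Graph n) (H H' M : List (Edge n)) → StandingChoice G H H' M
    → (vs : List (Fin n)) (l : ℕ) → MaximalAltPath M H vs → AltFrom M H vs
    → length vs ≡ 2 * l
    → 3 ≤ l
      × (∀ x y r → vs ≡ x ∷ y ∷ r → EdgeIn H' x y)
      × (∀ x y r → vs ≡ r ++ x ∷ y ∷ [] → EdgeIn H' x y)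
lemma5 G H H' M standing vs l ((distinct-vs , _) , maximal-vs) alt |vs|≡2l =
    *-cancelˡ-≤ 2 (subst (6 ≤_) |vs|≡2l (path-length≥6 P))
  , (λ x y r vs≡ → start-edge-∈H' (subst (OddMaximalAltPath M H) vs≡ P))
  , λ x y r vs≡ → EdgeIn-sym (start-edge-∈H' (subst (OddMaximalAltPath M H) (reverse-snoc vs≡) (reverse-path P)))
  where
  open Standing G H H' M standing
  P : OddMaximalAltPath M H vs
  P = record { distinct = distinct-vs ; maximal = maximal-vs ; alternating = alt
             ; even-length = subst Even (sym |vs|≡2l) (even-2* l) }
  reverse-snoc : ∀ {x y r} → vs ≡ r ++ x ∷ y ∷ [] → reverse vs ≡ y ∷ x ∷ reverse r
  reverse-snoc {x} {y} {r} vs≡ = trans (cong reverse vs≡) (reverse-++ r (x ∷ y ∷ []))
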